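{- If an infinite word $u$ over a finite alphabet has property $R_3$ (every factor has exactly three return words), then $u$ has no weak bispecial factor.
   Context: Factors of $u=u_0u_1\cdots$ are finite (possibly empty) words occurring in $u$. For a factor $w$, $\mathcal E_\ell(w)=\{a: aw \text{ is a factor}\}$, $\mathcal E_r(w)=\{b: wb\text{ is a factor}\}$. If $j<k$ are successive occurrences of $w$ (positions $j$ with $u_j\cdots u_{j+|w|-1}=w$), then $u_j\cdots u_{k-1}$ is a return word of $w$. The bilateral order of $w$ is $B(w)=\#\{awb \text{ factor of } u: a,b \text{ letters}\}-\#\mathcal E_\ell(w)-\#\mathcal E_r(w)+1$, and $w$ is weak bispecial if $B(w)<0$. -}

module Defs where

open import Data.Nat using (ℕ; zero; suc; _+_; _∸_; _<_; _≤_)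
open import Data.Fin using (Fin)
open import Data.List using (List; []; _∷_; length; _++_; [_])
open import Data.List.Membership.Propositional using (_∈_)
open import Data.List.Relation.Unary.Unique.Propositional using (Unique)
open import Data.Product using (Σ; ∃; _×_; _,_)
open import Data.Integer as ℤ using (ℤ; +_)
open import Function.Bundles using (_⇔_)
open import Relation.Binary.PropositionalEquality using (_≡_; _≢_)
open import Relation.Nullary using (¬_)

Word : ℕ → Set
Word d = ℕ → Fin d

FinWord : ℕ → Set
FinWord d = List (Fin d)

slice : ∀ {d} → Word d → ℕ → ℕ → FinWord d
slice u i zero    = []
slice u i (suc n) = u i ∷ slice u (suc i) n

OccursAt : ∀ {d} → Word d → FinWord d → ℕ → Set
OccursAt u w i = slice u i (length w) ≡ w

Factor : ∀ {d} → Word d → FinWord d → Set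
Factor u w = ∃ λ i → OccursAt u w i

ReturnWord : ∀ {d} → Word d → FinWord d → FinWord d → Set
ReturnWord u w r =
  Σ ℕ λ j → Σ ℕ λ k →
    j < k × OccursAt u w j × OccursAt u w k ×
    (∀ m → j < m → m < k → ¬ OccursAt u w m) ×
    r ≡ slice u j (k ∸ j)

HasExactlyThreeReturnWords : ∀ {d} → Word d → FinWord d → Set
HasExactlyThreeReturnWords u w =
  Σ (FinWord _) λ r₁ → Σ (FinWord _) λ r₂ → Σ (FinWord _) λ r₃ →
    r₁ ≢ r₂ × r₁ ≢ r₃ × r₂ ≢ r₃ ×
    ReturnWord u w r₁ × ReturnWord u w r₂ × ReturnWord u w r₃ ×
    (∀ r → ReturnWord u w r → r ≡ r₁ ⊎' r ≡ r₂ ⊎' r ≡ r₃)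
  where
    open import Data.Sum renaming (_⊎_ to _⊎'_)

R₃ : ∀ {d} → Word d → Set
R₃ u = ∀ w → Factor u w → HasExactlyThreeReturnWords u w

HasCard : {A : Set} → (A → Set) → ℕ → Set
HasCard {A} P n = Σ (List A) λ L → length L ≡ n × Unique L × (∀ a → (a ∈ L) ⇔ P a)

LeftExt : ∀ {d} → Word d → FinWord d → Fin d → Set
LeftExt u w a = Factor u (a ∷ w)

RightExt : ∀ {d} → Word d → FinWord d → Fin d → Set
RightExt u w b = Factor u (w ++ [ b ])

BiExt : ∀ {d} → Word d → FinWord d → Fin d × Fin d → Set
BiExt u w (a , b) = Factor u (a ∷ w ++ [ b ])

bilateral : ℕ → ℕ → ℕ → ℤ
bilateral nb nl nr = (((+ nb) ℤ.- (+ nl)) ℤ.- (+ nr)) ℤ.+ (+ 1)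

WeakBispecial : ∀ {d} → Word d → FinWord d → Set
WeakBispecial u w =
  Σ ℕ λ nb → Σ ℕ λ nl → Σ ℕ λ nr →
    HasCard (BiExt u w) nb × HasCard (LeftExt u w) nl × HasCard (RightExt u w) nr ×
    bilateral nb nl nr ℤ.< + 0

-- Let R₀, R₁, R₂ be the return words of w and give each occurrence of w the type i of the
-- return word starting there. The letter following w and the letter preceding the next
-- occurrence (the last letter of Rᵢ) depend only on the type, so the left and right extensions
-- of w are counted by the blocks of two partitions of {0, 1, 2}, and consecutive occurrences of
-- types i, j produce the bi-extension (last letter of Rᵢ, letter following type j). A return
-- word of w b is the product of the return words along an excursion of this transition graph
-- out of the block of types followed by b, and is determined by its start; dually, a return
-- word of a w is determined by the end of an excursion into the block of types whose return
-- word ends with a. An exhaustive check over all pairs of partitions and all bi-extension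
-- tables shows that B(w) < 0 always leaves a block with at most two starts or two ends, so
-- w b or a w would have at most two return words.

module Submission where

open import Defs
open import Data.Bool using (Bool; true; false; T; not; _∧_; _∨_; if_then_else_)
open import Data.Bool.ListAction using (all; any)
open import Data.Bool.Properties using (T-∧; T-∨; T-≡)
open import Data.Empty using (⊥)
open import Data.Fin using (Fin; zero; suc)
import Data.Fin.Properties as Fin
import Data.Integer as ℤ
import Data.Integer.Properties as ℤₚ
open import Data.Integer.Tactic.RingSolver using (solve-∀)
open import Data.List
  using (List; []; _∷_; _++_; [_]; _∷ʳ_; map; concatMap; allFin; length; filter; drop; deduplicate
        ; cartesianProduct; cartesianProductWith)
open import Data.List.Membership.Propositional using (_∈_; lose)
open import Data.List.Membership.Propositional.Properties
  using (∈-∃++; ∈-++⁻; ∈-++⁺ˡ; ∈-++⁺ʳ; ∈-map⁺; ∈-map⁻; ∈-allFin; ∈-concatMap⁺; ∈-cartesianProductWith⁺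
        ; ∈-deduplicate⁺; ∈-filter⁻)
import Data.List.Properties as List
open import Data.List.Relation.Binary.Subset.Propositional using (_⊆_)
open import Data.List.Relation.Unary.All as All using ([]; _∷_)
open import Data.List.Relation.Unary.All.Properties using (all⁺)
open import Data.List.Relation.Unary.Any as Any using (here; there)
open import Data.List.Relation.Unary.Any.Properties using (any⁻)
open import Data.List.Relation.Unary.Unique.Propositional using (Unique; []; _∷_)
import Data.List.Relation.Unary.Unique.Propositional.Properties as Unique
open import Data.Nat using (ℕ; zero; suc; _+_; _∸_; _≤_; _<_; z≤n; s≤s; _≤ᵇ_; _<ᵇ_)
open import Data.Nat.Induction using (<-wellFounded)
open import Data.Nat.Properties
open import Data.Product using (∃; _×_; _,_; proj₁; proj₂; map₁)
import Data.Product.Properties as Product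
open import Data.Sum using (inj₁; inj₂) renaming ([_,_] to either)
open import Data.Vec using (Vec; []; _∷_; lookup; tabulate)
open import Data.Vec.Properties using (lookup∘tabulate)
open import Function using (_∘_; Equivalence; _⇔_; mk⇔)
open import Function.Properties.Equivalence using () renaming (trans to ⇔-trans; sym to ⇔-sym)
open import Function.Definitions using (Injective)
open import Induction.WellFounded using (Acc; acc)
open import Relation.Binary.Definitions using (DecidableEquality)
open import Relation.Binary.PropositionalEquality hiding ([_])
open import Relation.Nullary using (¬_; Dec; yes; no; does; contradiction)
open import Relation.Nullary.Decidable using (T?; dec-true)

Unique-⊆⇒length-≤ : {A : Set} {xs ys : List A} → Unique xs → xs ⊆ ys → length xs ≤ length ys
Unique-⊆⇒length-≤ {xs = []} _ _ = z≤n
Unique-⊆⇒length-≤ {xs = x ∷ xs} (x∉xs ∷ unique) x∷xs⊆ys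
  with ys₁ , ys₂ , refl ← ∈-∃++ (x∷xs⊆ys (here refl)) = begin
    suc (length xs)              ≤⟨ s≤s (Unique-⊆⇒length-≤ unique xs⊆ys₁++ys₂) ⟩
    suc (length (ys₁ ++ ys₂))    ≡⟨ List.length-++-sucʳ ys₁ x ys₂ ⟨
    length (ys₁ ++ x ∷ ys₂)      ∎
  where
  open ≤-Reasoning
  xs⊆ys₁++ys₂ : xs ⊆ ys₁ ++ ys₂
  xs⊆ys₁++ys₂ z∈xs with ∈-++⁻ ys₁ (x∷xs⊆ys (there z∈xs))
  ... | inj₁ z∈ys₁         = ∈-++⁺ˡ z∈ys₁
  ... | inj₂ (here refl)   = contradiction refl (All.lookup x∉xs z∈xs)
  ... | inj₂ (there z∈ys₂) = ∈-++⁺ʳ ys₁ z∈ys₂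

HasCard-≤-image : {A : Set} {P : A → Set} {n m : ℕ} (f : Fin m → A) → HasCard P n →
                  (∀ {a} → P a → ∃ λ i → a ≡ f i) → n ≤ m
HasCard-≤-image {n = n} {m} f (xs , length≡n , unique , ∈⇔P) image = begin
  n                          ≡⟨ length≡n ⟨
  length xs                  ≤⟨ Unique-⊆⇒length-≤ unique xs⊆image ⟩
  length (map f (allFin m))  ≡⟨ List.length-map f (allFin m) ⟩
  length (allFin m)          ≡⟨ List.length-tabulate _ ⟩
  m                          ∎
  where
  open ≤-Reasoning
  xs⊆image : xs ⊆ map f (allFin m)
  xs⊆image a∈xs =
    let i , a≡fi = image (Equivalence.to (∈⇔P _) a∈xs) in subst (_∈ _) (sym a≡fi) (∈-map⁺ f (∈-allFin i))

HasCard-≥-injection : {A B : Set} {P : A → Set} {n : ℕ} (f : B → A) → Injective _≡_ _≡_ f → HasCard P n →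
                      ∀ {ys} → Unique ys → (∀ {y} → y ∈ ys → P (f y)) → length ys ≤ n
HasCard-≥-injection {n = n} f f-injective (xs , length≡n , _ , ∈⇔P) {ys} unique P∘f = begin
  length ys          ≡⟨ List.length-map f ys ⟨
  length (map f ys)  ≤⟨ Unique-⊆⇒length-≤ (Unique.map⁺ f-injective unique) f[ys]⊆xs ⟩
  length xs          ≡⟨ length≡n ⟩
  n                  ∎
  where
  open ≤-Reasoning
  f[ys]⊆xs : map f ys ⊆ xs
  f[ys]⊆xs fy∈ with _ , y∈ys , refl ← ∈-map⁻ f fy∈ = Equivalence.from (∈⇔P _) (P∘f y∈ys)

module _ {A : Set} (_≟_ : DecidableEquality A) where

  atMostTwo : List A → Bool
  atMostTwo xs = length (deduplicate _≟_ xs) ≤ᵇ 2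

  atMostTwo-pigeonhole : ∀ {xs a b c} → T (atMostTwo xs) → a ∈ xs → b ∈ xs → c ∈ xs →
                         a ≢ b → a ≢ c → b ≢ c → ⊥
  atMostTwo-pigeonhole {xs} few a∈xs b∈xs c∈xs a≢b a≢c b≢c =
    3≰2 (≤-trans (Unique-⊆⇒length-≤ distinct abc⊆) (≤ᵇ⇒≤ _ 2 few))
    where
    3≰2 : ¬ 3 ≤ 2
    3≰2 (s≤s (s≤s ()))
    distinct : Unique (_ ∷ _ ∷ _ ∷ [])
    distinct = (a≢b ∷ a≢c ∷ []) ∷ (b≢c ∷ []) ∷ [] ∷ []
    abc⊆ : _ ∷ _ ∷ _ ∷ [] ⊆ deduplicate _≟_ xs
    abc⊆ (here refl)                 = ∈-deduplicate⁺ _≟_ a∈xs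
    abc⊆ (there (here refl))         = ∈-deduplicate⁺ _≟_ b∈xs
    abc⊆ (there (there (here refl))) = ∈-deduplicate⁺ _≟_ c∈xs

does≡true⇒ : {A : Set} (a? : Dec A) → does a? ≡ true → A
does≡true⇒ (yes a) _ = a

vectors : {A : Set} → List A → (n : ℕ) → List (Vec A n)
vectors xs zero    = [ [] ]
vectors xs (suc n) = cartesianProductWith _∷_ xs (vectors xs n)

∈-vectors : {A : Set} {xs : List A} → (∀ a → a ∈ xs) → ∀ {n} (v : Vec A n) → v ∈ vectors xs n
∈-vectors every []      = here refl
∈-vectors every (a ∷ v) = ∈-cartesianProductWith⁺ _∷_ (every a) (∈-vectors every v)

-- Excursions of a directed graph out of a set of vertices

module Excursions {k : ℕ} (S : Fin k → Bool) (G : Fin k → Fin k → Bool) where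

  data Outside : Fin k → List (Fin k) → Fin k → Set where
    exit : ∀ {x z} → G x z ≡ true → S z ≡ true → Outside x [] z
    hop  : ∀ {x y ys z} → G x y ≡ true → S y ≡ false → Outside y ys z → Outside x (y ∷ ys) z

  Excursion : Set
  Excursion = Fin k × List (Fin k) × Fin k

  IsExcursion : Excursion → Set
  IsExcursion (x , ys , z) = S x ≡ true × Outside x ys z

  mutual
    outsideWalks : ℕ → Fin k → List (List (Fin k) × Fin k)
    outsideWalks zero    x = []
    outsideWalks (suc n) x = concatMap (outsideWalksVia n x) (allFin k)

    outsideWalksVia : ℕ → Fin k → Fin k → List (List (Fin k) × Fin k)
    outsideWalksVia n x y =
      if G x y then (if S y then [ [] , y ] else map (map₁ (y ∷_)) (outsideWalks n y)) else []

  reentersWithin : ℕ → Fin k → Bool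
  reentersWithin zero    x = false
  reentersWithin (suc n) x = all (λ y → not (G x y) ∨ S y ∨ reentersWithin n y) (allFin k)

  excursions : ℕ → List Excursion
  excursions n = concatMap (λ x → if S x then map (x ,_) (outsideWalks n x) else []) (allFin k)

  bounded : ℕ → Bool
  bounded n = all (λ x → not (S x) ∨ reentersWithin n x) (allFin k)

  outsideWalks-complete : ∀ n {x ys z} → T (reentersWithin n x) → Outside x ys z →
                          (ys , z) ∈ outsideWalks n x
  outsideWalks-complete (suc n) {x} _ (exit {z = z} gxz sz) =
    ∈-concatMap⁺ _ (lose (∈-allFin z) via-z)
    where
    via-z : ([] , z) ∈ outsideWalksVia n x z
    via-z rewrite gxz | sz = here refl
  outsideWalks-complete (suc n) {x} within (hop {y = y} {ys} {z} gxy sy walk) =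
    ∈-concatMap⁺ _ (lose (∈-allFin y) via-y)
    where
    within-y : T (reentersWithin n y)
    within-y with All.lookup (all⁺ _ (allFin k) within) (∈-allFin y)
    ... | t rewrite gxy | sy = t
    via-y : (y ∷ ys , z) ∈ outsideWalksVia n x y
    via-y rewrite gxy | sy = ∈-map⁺ (map₁ (y ∷_)) (outsideWalks-complete n within-y walk)

  excursions-complete : ∀ {n e} → T (bounded n) → IsExcursion e → e ∈ excursions n
  excursions-complete {n} {x , ys , z} bounds (sx , walk) = ∈-concatMap⁺ _ (lose (∈-allFin x) from-x)
    where
    within-x : T (reentersWithin n x)
    within-x with All.lookup (all⁺ _ (allFin k) bounds) (∈-allFin x)
    ... | t rewrite sx = t
    from-x : (x , ys , z) ∈ (if S x then map (x ,_) (outsideWalks n x) else [])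
    from-x rewrite sx = ∈-map⁺ (x ,_) (outsideWalks-complete n within-x walk)

  start : Excursion → Fin k × List (Fin k)
  start (x , ys , _) = x , ys

  end : Excursion → List (Fin k) × Fin k
  end (_ , ys , z) = ys , z

  fewKeys : {K : Set} → DecidableEquality K → (Excursion → K) → ℕ → Bool
  fewKeys _≟_ key n = bounded n ∧ atMostTwo _≟_ (map key (excursions n))

  fewStarts fewEnds : ℕ → Bool
  fewStarts = fewKeys (Product.≡-dec Fin._≟_ (List.≡-dec Fin._≟_)) start
  fewEnds   = fewKeys (Product.≡-dec (List.≡-dec Fin._≟_) Fin._≟_) end

-- Set partitions of a three-element set, as restricted growth strings

data Partition₃ : Set where
  aaa aab aba abb abc : Partition₃

partitions : List Partition₃
partitions = aaa ∷ aab ∷ aba ∷ abb ∷ abc ∷ []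

∈-partitions : ∀ π → π ∈ partitions
∈-partitions aaa = here refl
∈-partitions aab = there (here refl)
∈-partitions aba = there (there (here refl))
∈-partitions abb = there (there (there (here refl)))
∈-partitions abc = there (there (there (there (here refl))))

blocks : Partition₃ → ℕ
blocks aaa = 1
blocks aab = 2
blocks aba = 2
blocks abb = 2
blocks abc = 3

block : (π : Partition₃) → Fin 3 → Fin (blocks π)
block aaa _             = zero
block aab zero          = zero
block aab (suc zero)    = zero
block aab (suc (suc _)) = suc zero
block aba zero          = zero
block aba (suc zero)    = suc zero
block aba (suc (suc _)) = zero
block abb zero          = zero
block abb (suc _)       = suc zero
block abc x             = x

sameBlock : Partition₃ → Fin 3 → Fin 3 → Bool
sameBlock π i x = does (block π x Fin.≟ block π i)

sameBlock⇔ : ∀ π {i x} → sameBlock π i x ≡ true ⇔ block π x ≡ block π i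
sameBlock⇔ π {i} {x} = mk⇔ (does≡true⇒ (block π x Fin.≟ block π i)) (dec-true (block π x Fin.≟ block π i))

pair : {A : Set} → A → A → Fin 2 → A
pair a b zero       = a
pair a b (suc zero) = b

pair-injective : {A : Set} {a b : A} → a ≢ b → Injective _≡_ _≡_ (pair a b)
pair-injective a≢b {zero}     {zero}     _ = refl
pair-injective a≢b {suc zero} {suc zero} _ = refl
pair-injective a≢b {zero}     {suc zero} e = contradiction e a≢b
pair-injective a≢b {suc zero} {zero}     e = contradiction (sym e) a≢b

record Factorisation {A : Set} (f : Fin 3 → A) : Set where
  field
    partition       : Partition₃
    label           : Fin (blocks partition) → A
    label-injective : Injective _≡_ _≡_ label
    factorises      : ∀ x → f x ≡ label (block partition x)

  same-value⇔same-block : ∀ {x y} → f x ≡ f y ⇔ block partition x ≡ block partition y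
  same-value⇔same-block {x} {y} = mk⇔
    (λ fx≡fy → label-injective (trans (sym (factorises x)) (trans fx≡fy (factorises y))))
    (λ same → trans (factorises x) (trans (cong label same) (sym (factorises y))))

factorise : {A : Set} → DecidableEquality A → (f : Fin 3 → A) → Factorisation f
factorise _≟_ f with f zero ≟ f (suc zero) | f zero ≟ f (suc (suc zero)) | f (suc zero) ≟ f (suc (suc zero))
... | yes f₀≡f₁ | yes f₀≡f₂ | _ = record
  { partition = aaa ; label = λ _ → f zero
  ; label-injective = λ { {zero} {zero} _ → refl }
  ; factorises = λ { zero → refl ; (suc zero) → sym f₀≡f₁ ; (suc (suc zero)) → sym f₀≡f₂ } }
... | yes f₀≡f₁ | no f₀≢f₂ | _ = record
  { partition = aab ; label = pair (f zero) (f (suc (suc zero)))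
  ; label-injective = pair-injective f₀≢f₂
  ; factorises = λ { zero → refl ; (suc zero) → sym f₀≡f₁ ; (suc (suc zero)) → refl } }
... | no f₀≢f₁ | yes f₀≡f₂ | _ = record
  { partition = aba ; label = pair (f zero) (f (suc zero))
  ; label-injective = pair-injective f₀≢f₁
  ; factorises = λ { zero → refl ; (suc zero) → refl ; (suc (suc zero)) → sym f₀≡f₂ } }
... | no f₀≢f₁ | no _ | yes f₁≡f₂ = record
  { partition = abb ; label = pair (f zero) (f (suc zero))
  ; label-injective = pair-injective f₀≢f₁
  ; factorises = λ { zero → refl ; (suc zero) → refl ; (suc (suc zero)) → sym f₁≡f₂ } }
... | no f₀≢f₁ | no f₀≢f₂ | no f₁≢f₂ = record
  { partition = abc ; label = f ; label-injective = injective ; factorises = λ _ → refl }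
  where
  injective : Injective _≡_ _≡_ f
  injective {zero}           {zero}           _ = refl
  injective {suc zero}       {suc zero}       _ = refl
  injective {suc (suc zero)} {suc (suc zero)} _ = refl
  injective {zero}           {suc zero}       e = contradiction e f₀≢f₁
  injective {zero}           {suc (suc zero)} e = contradiction e f₀≢f₂
  injective {suc zero}       {zero}           e = contradiction (sym e) f₀≢f₁
  injective {suc zero}       {suc (suc zero)} e = contradiction e f₁≢f₂
  injective {suc (suc zero)} {zero}           e = contradiction (sym e) f₀≢f₂
  injective {suc (suc zero)} {suc zero}       e = contradiction (sym e) f₁≢f₂

Table : ℕ → ℕ → Set
Table m n = Vec (Vec Bool n) m

entry : ∀ {m n} → Table m n → Fin m → Fin n → Bool
entry t i j = lookup (lookup t i) j

tables : ∀ m n → List (Table m n)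
tables m n = vectors (vectors (true ∷ false ∷ []) n) m

∈-tables : ∀ {m n} (t : Table m n) → t ∈ tables m n
∈-tables = ∈-vectors (∈-vectors λ { true → here refl ; false → there (here refl) })

-- The types of occurrences of w are Fin 3; πˡ and πʳ are the kernels of the last-letter and
-- right-letter maps, and t records which pairs of blocks are bi-extensions of w.
module Configuration (πˡ πʳ : Partition₃) (t : Table (blocks πˡ) (blocks πʳ)) where

  G : Fin 3 → Fin 3 → Bool
  G x y = entry t (block πˡ x) (block πʳ y)

  edges : List (Fin (blocks πˡ) × Fin (blocks πʳ))
  edges = filter (λ (i , j) → T? (entry t i j)) (cartesianProduct (allFin _) (allFin _))

  -- Three hops suffice: outside a nonempty block there are at most two types.
  refutedAt : Fin 3 → Bool
  refutedAt i = Excursions.fewStarts (sameBlock πʳ i) G 3 ∨ Excursions.fewEnds (sameBlock πˡ i) G 3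

  isWeak isRefuted : Bool
  isWeak    = length edges + 1 <ᵇ blocks πˡ + blocks πʳ
  isRefuted = any refutedAt (allFin 3)

weak-configurations-are-refuted : ∀ πˡ πʳ t → T (Configuration.isWeak πˡ πʳ t) →
                                  T (Configuration.isRefuted πˡ πʳ t)
weak-configurations-are-refuted πˡ πʳ t =
  implies (all-lookup (check πˡ πʳ) (all-lookup (checkTables πˡ) (all-lookup checkPartitions checked
    (∈-partitions πˡ)) (∈-partitions πʳ)) (∈-tables t))
  where
  check : ∀ πˡ πʳ → Table (blocks πˡ) (blocks πʳ) → Bool
  check πˡ πʳ t = not (Configuration.isWeak πˡ πʳ t) ∨ Configuration.isRefuted πˡ πʳ t
  checkTables : Partition₃ → Partition₃ → Bool
  checkTables πˡ πʳ = all (check πˡ πʳ) (tables _ _)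
  checkPartitions : Partition₃ → Bool
  checkPartitions πˡ = all (checkTables πˡ) partitions
  checked : T (all checkPartitions partitions)
  checked = _
  all-lookup : ∀ {A : Set} (p : A → Bool) {xs x} → T (all p xs) → x ∈ xs → T (p x)
  all-lookup p {xs} h = All.lookup (all⁺ p xs h)
  implies : ∀ {a b} → T (not a ∨ b) → T a → T b
  implies {true} b _ = b

module _ {d : ℕ} (u : Word d) where

  length-slice : ∀ i n → length (slice u i n) ≡ n
  length-slice i zero    = refl
  length-slice i (suc n) = cong suc (length-slice (suc i) n)

  occurs-slice : ∀ i n → OccursAt u (slice u i n) i
  occurs-slice i n = cong (slice u i) (length-slice i n)

  slice-+ : ∀ i m n → slice u i (m + n) ≡ slice u i m ++ slice u (i + m) n
  slice-+ i zero    n = cong (λ j → slice u j n) (sym (+-identityʳ i))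
  slice-+ i (suc m) n = cong (u i ∷_) (begin
    slice u (suc i) (m + n)                        ≡⟨ slice-+ (suc i) m n ⟩
    slice u (suc i) m ++ slice u (suc i + m) n     ≡⟨ cong (λ j → slice u (suc i) m ++ slice u j n) (+-suc i m) ⟨
    slice u (suc i) m ++ slice u (i + suc m) n     ∎)
    where open ≡-Reasoning

  drop-slice : ∀ i m n → drop m (slice u i (m + n)) ≡ slice u (i + m) n
  drop-slice i zero    n = cong (λ j → slice u j n) (sym (+-identityʳ i))
  drop-slice i (suc m) n = trans (drop-slice (suc i) m n) (cong (λ j → slice u j n) (sym (+-suc i m)))

  slice-letter : ∀ {i j n m} → slice u i n ≡ slice u j n → m < n → u (i + m) ≡ u (j + m)
  slice-letter {i} {j} {suc n} {zero} eq _ = begin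
    u (i + 0) ≡⟨ cong u (+-identityʳ i) ⟩
    u i       ≡⟨ List.∷-injectiveˡ eq ⟩
    u j       ≡⟨ cong u (+-identityʳ j) ⟨
    u (j + 0) ∎
    where open ≡-Reasoning
  slice-letter {i} {j} {suc n} {suc m} eq (s≤s m<n) = begin
    u (i + suc m)   ≡⟨ cong u (+-suc i m) ⟩
    u (suc i + m)   ≡⟨ slice-letter (List.∷-injectiveʳ eq) m<n ⟩
    u (suc j + m)   ≡⟨ cong u (+-suc j m) ⟨
    u (j + suc m)   ∎
    where open ≡-Reasoning

  occurs-letter : ∀ {xs i j m} → OccursAt u xs i → OccursAt u xs j → m < length xs → u (i + m) ≡ u (j + m)
  occurs-letter xs-at-i xs-at-j = slice-letter (trans xs-at-i (sym xs-at-j))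

  occurs-++ : ∀ {xs ys i} → OccursAt u xs i → OccursAt u ys (i + length xs) → OccursAt u (xs ++ ys) i
  occurs-++ {xs} {ys} {i} xs-at ys-at = begin
    slice u i (length (xs ++ ys))                                  ≡⟨ cong (slice u i) (List.length-++ xs) ⟩
    slice u i (length xs + length ys)                              ≡⟨ slice-+ i (length xs) (length ys) ⟩
    slice u i (length xs) ++ slice u (i + length xs) (length ys)   ≡⟨ cong₂ _++_ xs-at ys-at ⟩
    xs ++ ys                                                       ∎
    where open ≡-Reasoning

  slice-∷ʳ : ∀ i xs (b : Fin d) → slice u i (length (xs ∷ʳ b)) ≡ slice u i (length xs) ∷ʳ u (i + length xs)
  slice-∷ʳ i xs b = trans (cong (slice u i) (List.length-++ xs)) (slice-+ i (length xs) 1)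

  occurs-∷ʳ⁻ : ∀ {xs b i} → OccursAt u (xs ∷ʳ b) i → OccursAt u xs i × u (i + length xs) ≡ b
  occurs-∷ʳ⁻ {xs} {b} {i} at = List.∷ʳ-injective _ xs (trans (sym (slice-∷ʳ i xs b)) at)

  occurs-∷ʳ⁺ : ∀ {xs b i} → OccursAt u xs i → u (i + length xs) ≡ b → OccursAt u (xs ∷ʳ b) i
  occurs-∷ʳ⁺ {xs} {b} {i} at eq = trans (slice-∷ʳ i xs b) (cong₂ _∷ʳ_ at eq)

  segment : ℕ → ℕ → FinWord d
  segment i j = slice u i (j ∸ i)

  segment-refl : ∀ i → segment i i ≡ []
  segment-refl i = cong (slice u i) (n∸n≡0 i)

  segment-split : ∀ {i j k} → i ≤ j → j ≤ k → segment i k ≡ segment i j ++ segment j k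
  segment-split {i} {j} {k} i≤j j≤k = begin
    slice u i (k ∸ i)                                     ≡⟨ cong (slice u i) k∸i≡ ⟩
    slice u i ((j ∸ i) + (k ∸ j))                         ≡⟨ slice-+ i (j ∸ i) (k ∸ j) ⟩
    slice u i (j ∸ i) ++ slice u (i + (j ∸ i)) (k ∸ j)    ≡⟨ cong (λ m → segment i j ++ slice u m (k ∸ j)) (m+[n∸m]≡n i≤j) ⟩
    segment i j ++ segment j k                            ∎
    where
    open ≡-Reasoning
    k∸i≡ : k ∸ i ≡ (j ∸ i) + (k ∸ j)
    k∸i≡ = begin
      k ∸ i                   ≡⟨ cong (_∸ i) (m∸n+n≡m j≤k) ⟨
      ((k ∸ j) + j) ∸ i       ≡⟨ +-∸-assoc (k ∸ j) i≤j ⟩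
      (k ∸ j) + (j ∸ i)       ≡⟨ +-comm (k ∸ j) (j ∸ i) ⟩
      (j ∸ i) + (k ∸ j)       ∎

  segment-last : ∀ {i j} → i < j → segment i j ≡ segment i (j ∸ 1) ∷ʳ u (j ∸ 1)
  segment-last {i} {suc j} (s≤s i≤j) = begin
    slice u i (suc j ∸ i)                     ≡⟨ cong (slice u i) (+-∸-assoc 1 i≤j) ⟩
    slice u i (suc (j ∸ i))                   ≡⟨ cong (slice u i) (+-comm 1 (j ∸ i)) ⟩
    slice u i ((j ∸ i) + 1)                   ≡⟨ slice-+ i (j ∸ i) 1 ⟩
    segment i j ∷ʳ u (i + (j ∸ i))            ≡⟨ cong (λ m → segment i j ∷ʳ u m) (m+[n∸m]≡n i≤j) ⟩
    segment i j ∷ʳ u j                        ∎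
    where open ≡-Reasoning

  segment-cons : ∀ {i j} → i < j → segment i j ≡ u i ∷ segment (suc i) j
  segment-cons {i} {suc j} (s≤s i≤j) = cong (slice u i) (+-∸-assoc 1 i≤j)

  Recurrent : Set
  Recurrent = ∀ {v i} → OccursAt u v i → ∃ λ j → i < j × OccursAt u v j

  occurs-beyond : Recurrent → ∀ {v i} → OccursAt u v i → ∀ m → ∃ λ j → m < j × OccursAt u v j
  occurs-beyond recurrent v-at zero = let j , i<j , v-at-j = recurrent v-at in j , ≤-<-trans z≤n i<j , v-at-j
  occurs-beyond recurrent v-at (suc m) =
    let j , m<j , v-at-j = occurs-beyond recurrent v-at m
        j′ , j<j′ , v-at-j′ = recurrent v-at-j
    in j′ , ≤-<-trans m<j j<j′ , v-at-j′

  return-words⇒recurrent : (∀ v → Factor u v → ∃ (ReturnWord u v)) → Recurrent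
  return-words⇒recurrent returns {v} {i} v-at
    with _ , _ , k , j<k , _ , prefix-at-k , _ ← returns (slice u 0 (i + length v)) (0 , occurs-slice 0 _)
    = k + i , m<n+m i (≤-<-trans z≤n j<k) , v-at-k+i
    where
    open ≡-Reasoning
    v-at-k+i : OccursAt u v (k + i)
    v-at-k+i = begin
      slice u (k + i) (length v)                              ≡⟨ drop-slice k i (length v) ⟨
      drop i (slice u k (i + length v))                       ≡⟨ cong (drop i ∘ slice u k) (length-slice 0 _) ⟨
      drop i (slice u k (length (slice u 0 (i + length v))))  ≡⟨ cong (drop i) prefix-at-k ⟩
      drop i (slice u 0 (i + length v))                       ≡⟨ drop-slice 0 i (length v) ⟩
      slice u i (length v)                                    ≡⟨ v-at ⟩
      v                                                       ∎

module Occurrences {d : ℕ} (u : Word d) (recurrent : Recurrent u) (w : FinWord d) (w-factor : Factor u w) where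

  Occ : ℕ → Set
  Occ = OccursAt u w

  occ? : ∀ p → Dec (Occ p)
  occ? p = List.≡-dec Fin._≟_ (slice u p (length w)) w

  NoOccBetween : ℕ → ℕ → Set
  NoOccBetween p q = ∀ m → p < m → m < q → ¬ Occ m

  no-occ-between-suc : ∀ p → NoOccBetween p (suc p)
  no-occ-between-suc p m p<m m<1+p _ = <⇒≱ p<m (m<1+n⇒m≤n m<1+p)

  first-occurrence-after : ∀ p k → Occ (suc p + k) → ∃ λ q → p < q × Occ q × NoOccBetween p q
  first-occurrence-after p zero occ =
    suc p , ≤-refl , subst Occ (+-identityʳ (suc p)) occ , no-occ-between-suc p
  first-occurrence-after p (suc k) occ with occ? (suc p)
  ... | yes occ₁ = suc p , ≤-refl , occ₁ , no-occ-between-suc p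
  ... | no ¬occ₁ =
    let q , 1+p<q , occ-q , none = first-occurrence-after (suc p) k (subst Occ (+-suc (suc p) k) occ)
    in q , <-trans (n<1+n p) 1+p<q , occ-q , none′ none
    where
    none′ : ∀ {q} → NoOccBetween (suc p) q → NoOccBetween p q
    none′ none m p<m m<q with m≤n⇒m<n∨m≡n p<m
    ... | inj₁ 1+p<m = none m 1+p<m m<q
    ... | inj₂ refl  = ¬occ₁

  opaque
    next-occurrence : ∀ p → ∃ λ q → p < q × Occ q × NoOccBetween p q
    next-occurrence p =
      let q , p<q , occ-q = occurs-beyond u recurrent (proj₂ w-factor) p
      in first-occurrence-after p (q ∸ suc p) (subst Occ (sym (m+[n∸m]≡n p<q)) occ-q)

  next : ℕ → ℕ
  next p = proj₁ (next-occurrence p)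

  p<next : ∀ p → p < next p
  p<next p = proj₁ (proj₂ (next-occurrence p))

  next-occurs : ∀ p → Occ (next p)
  next-occurs p = proj₁ (proj₂ (proj₂ (next-occurrence p)))

  next-first : ∀ p → NoOccBetween p (next p)
  next-first p = proj₂ (proj₂ (proj₂ (next-occurrence p)))

  next-≤ : ∀ {p q} → p < q → Occ q → next p ≤ q
  next-≤ {p} {q} p<q occ-q with next p ≤? q
  ... | yes next≤q = next≤q
  ... | no next≰q  = contradiction occ-q (next-first p q p<q (≰⇒> next≰q))

  next-unique : ∀ {p q} → p < q → Occ q → NoOccBetween p q → next p ≡ q
  next-unique {p} {q} p<q occ-q none with m≤n⇒m<n∨m≡n (next-≤ p<q occ-q)
  ... | inj₁ next<q = contradiction (next-occurs p) (none (next p) (p<next p) next<q)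
  ... | inj₂ next≡q = next≡q

  previous : ∀ {c k} → Occ c → c < k → Occ k → ∃ λ p → c ≤ p × Occ p × next p ≡ k
  previous = go (<-wellFounded _)
    where
    go : ∀ {c k} → Acc _<_ (k ∸ c) → Occ c → c < k → Occ k → ∃ λ p → c ≤ p × Occ p × next p ≡ k
    go {c} {k} (acc rec) occ-c c<k occ-k with m≤n⇒m<n∨m≡n (next-≤ c<k occ-k)
    ... | inj₂ next≡k = c , ≤-refl , occ-c , next≡k
    ... | inj₁ next<k =
      let p , next≤p , occ-p , next-p≡k =
            go (rec (∸-monoʳ-< (p<next c) (<⇒≤ next<k))) (next-occurs c) next<k occ-k
      in p , ≤-trans (<⇒≤ (p<next c)) next≤p , occ-p , next-p≡k

  segment-next-returns : ∀ {p} → Occ p → ReturnWord u w (segment u p (next p))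
  segment-next-returns {p} occ = p , next p , p<next p , occ , next-occurs p , next-first p , refl

  window : ∀ {p} → Occ p → OccursAt u (segment u p (next p) ++ w) p
  window {p} occ = occurs-++ u (occurs-slice u p _) (subst Occ next≡ (next-occurs p))
    where
    next≡ : next p ≡ p + length (segment u p (next p))
    next≡ = trans (sym (m+[n∸m]≡n (<⇒≤ (p<next p)))) (cong (p +_) (sym (length-slice u p _)))

-- Occurrences typed by three return words

module TypedOccurrences {d : ℕ} (u : Word d) (recurrent : Recurrent u) (w : FinWord d) (w-factor : Factor u w)
                        (R : Fin 3 → FinWord d) (R-returns : ∀ i → ReturnWord u w (R i))
                        (R-covers : ∀ {r} → ReturnWord u w r → ∃ λ i → r ≡ R i) where

  open Occurrences u recurrent w w-factor public

  index : FinWord d → Fin 3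
  index r with List.≡-dec Fin._≟_ r (R zero) | List.≡-dec Fin._≟_ r (R (suc zero))
  ... | yes _ | _     = zero
  ... | no _  | yes _ = suc zero
  ... | no _  | no _  = suc (suc zero)

  R-index : ∀ i → R (index (R i)) ≡ R i
  R-index i with List.≡-dec Fin._≟_ (R i) (R zero) | List.≡-dec Fin._≟_ (R i) (R (suc zero))
  R-index i                | yes Rᵢ≡R₀ | _         = sym Rᵢ≡R₀
  R-index i                | no _      | yes Rᵢ≡R₁ = sym Rᵢ≡R₁
  R-index zero             | no Rᵢ≢R₀  | no _      = contradiction refl Rᵢ≢R₀
  R-index (suc zero)       | no _      | no Rᵢ≢R₁  = contradiction refl Rᵢ≢R₁
  R-index (suc (suc zero)) | no _      | no _      = refl

  type : ℕ → Fin 3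
  type p = index (segment u p (next p))

  R-type : ∀ {p} → Occ p → R (type p) ≡ segment u p (next p)
  R-type occ with i , eq ← R-covers (segment-next-returns occ) =
    trans (cong (R ∘ index) eq) (trans (R-index i) (sym eq))

  representative : ∀ i → ∃ λ p → Occ p × segment u p (next p) ≡ R i
  representative i with j , k , j<k , occ-j , occ-k , none , eq ← R-returns i =
    j , occ-j , trans (cong (segment u j) (next-unique j<k occ-k none)) (sym eq)

  rep : Fin 3 → ℕ
  rep i = proj₁ (representative i)

  rep-occurs : ∀ i → Occ (rep i)
  rep-occurs i = proj₁ (proj₂ (representative i))

  rightLetter lastLetter : Fin 3 → Fin d
  rightLetter i = u (rep i + length w)
  lastLetter i = u (next (rep i) ∸ 1)

  typed-window : ∀ {p} → Occ p → OccursAt u (R (type p) ++ w) p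
  typed-window occ = subst (λ r → OccursAt u (r ++ w) _) (sym (R-type occ)) (window occ)

  rep-window : ∀ i → OccursAt u (R i ++ w) (rep i)
  rep-window i =
    subst (λ r → OccursAt u (r ++ w) _) (proj₂ (proj₂ (representative i))) (window (rep-occurs i))

  rightLetter-type : ∀ {p} → Occ p → u (p + length w) ≡ rightLetter (type p)
  rightLetter-type {p} occ = occurs-letter u (typed-window occ) (rep-window (type p)) w-inside
    where
    R-nonempty : 0 < length (R (type p))
    R-nonempty = subst (0 <_) (sym (trans (cong length (R-type occ)) (length-slice u p _)))
                       (m<n⇒0<n∸m (p<next p))
    w-inside : length w < length (R (type p) ++ w)
    w-inside = subst (length w <_) (sym (List.length-++ (R (type p)))) (m<n+m (length w) R-nonempty)

  lastLetter-type : ∀ {p} → Occ p → u (next p ∸ 1) ≡ lastLetter (type p)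
  lastLetter-type {p} occ = List.∷ʳ-injectiveʳ _ _ (begin
    segment u p (next p ∸ 1) ∷ʳ u (next p ∸ 1)          ≡⟨ segment-last u (p<next p) ⟨
    segment u p (next p)                                ≡⟨ R-type occ ⟨
    R (type p)                                          ≡⟨ proj₂ (proj₂ (representative (type p))) ⟨
    segment u (rep (type p)) (next (rep (type p)))      ≡⟨ segment-last u (p<next (rep (type p))) ⟩
    segment u (rep (type p)) ℓ ∷ʳ lastLetter (type p)   ∎)
    where
    open ≡-Reasoning
    ℓ = next (rep (type p)) ∸ 1

  1+[next∸1]≡next : ∀ p → suc (next p ∸ 1) ≡ next p
  1+[next∸1]≡next p = m+[n∸m]≡n (≤-trans (s≤s z≤n) (p<next p))

  transition : ∀ {p} → Occ p → BiExt u w (lastLetter (type p) , rightLetter (type (next p)))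
  transition {p} occ = next p ∸ 1 , cong₂ _∷_ (lastLetter-type occ) w-right-at
    where
    w-right-at : OccursAt u (w ∷ʳ rightLetter (type (next p))) (suc (next p ∸ 1))
    w-right-at = subst (OccursAt u _) (sym (1+[next∸1]≡next p))
                  (occurs-∷ʳ⁺ u (next-occurs p) (rightLetter-type (next-occurs p)))

  left-extension-type : ∀ {a} → LeftExt u w a → ∃ λ i → a ≡ lastLetter i
  left-extension-type {a} (_ , aw-at₀) =
    let q , c<q , aw-at = occurs-beyond u recurrent aw-at₀ (proj₁ w-factor)
        p , _ , occ-p , next-p≡1+q = previous (proj₂ w-factor) (m<n⇒m<1+n c<q) (List.∷-injectiveʳ aw-at)
    in type p , (begin
      a                     ≡⟨ List.∷-injectiveˡ aw-at ⟨
      u q                   ≡⟨ cong (λ n → u (n ∸ 1)) next-p≡1+q ⟨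
      u (next p ∸ 1)        ≡⟨ lastLetter-type occ-p ⟩
      lastLetter (type p)   ∎)
    where open ≡-Reasoning

  right-extension-type : ∀ {b} → RightExt u w b → ∃ λ i → b ≡ rightLetter i
  right-extension-type (p , wb-at) =
    let occ , b≡ = occurs-∷ʳ⁻ u wb-at in type p , trans (sym b≡) (rightLetter-type occ)

  module Walks (S : Fin 3 → Bool) (G : Fin 3 → Fin 3 → Bool)
               (G-step : ∀ {p} → Occ p → G (type p) (type (next p)) ≡ true) where

    open Excursions S G public

    unfoldStart : Fin 3 × List (Fin 3) → FinWord d
    unfoldStart (x , ys) = concatMap R (x ∷ ys)

    unfoldEnd : List (Fin 3) × Fin 3 → FinWord d
    unfoldEnd (ys , z) = concatMap R ys ++ R z

    outside-walk : ∀ {x c k} → c ≤ k → Occ c → Occ k → S (type k) ≡ true →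
                   (∀ {m} → c ≤ m → m < k → Occ m → S (type m) ≡ false) → G x (type c) ≡ true →
                   ∃ λ ys → Outside x ys (type k) × segment u c k ≡ concatMap R ys
    outside-walk = go (<-wellFounded _)
      where
      go : ∀ {x c k} → Acc _<_ (k ∸ c) → c ≤ k → Occ c → Occ k → S (type k) ≡ true →
           (∀ {m} → c ≤ m → m < k → Occ m → S (type m) ≡ false) → G x (type c) ≡ true →
           ∃ λ ys → Outside x ys (type k) × segment u c k ≡ concatMap R ys
      go {c = c} {k} (acc rec) c≤k occ-c occ-k S-k outside G-xc with m≤n⇒m<n∨m≡n c≤k
      ... | inj₂ refl = [] , exit G-xc S-k , segment-refl u c
      ... | inj₁ c<k =
        let ys , walk , segment≡ = go (rec (∸-monoʳ-< (p<next c) next≤k)) next≤k (next-occurs c) occ-k S-k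
                                      (outside ∘ ≤-trans (<⇒≤ (p<next c))) (G-step occ-c)
        in type c ∷ ys , hop G-xc (outside ≤-refl c<k occ-c) walk , (begin
          segment u c k                                  ≡⟨ segment-split u (<⇒≤ (p<next c)) next≤k ⟩
          segment u c (next c) ++ segment u (next c) k   ≡⟨ cong₂ _++_ (sym (R-type occ-c)) segment≡ ⟩
          R (type c) ++ concatMap R ys                   ∎)
        where
        open ≡-Reasoning
        next≤k : next c ≤ k
        next≤k = next-≤ c<k occ-k

    return-word-as-start : ∀ {v r} → (∀ {p} → OccursAt u v p → Occ p × S (type p) ≡ true) →
                           (∀ {p} → Occ p → S (type p) ≡ true → OccursAt u v p) → ReturnWord u v r →
                           ∃ λ e → IsExcursion e × r ≡ unfoldStart (start e)
    return-word-as-start {v} {r} v⇒S S⇒v (j , k , j<k , v-at-j , v-at-k , none , r≡) =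
      let ys , walk , segment≡ = outside-walk next≤k (next-occurs j) occ-k S-k outside (G-step occ-j)
      in (type j , ys , type k) , (S-j , walk) , (begin
        r                                              ≡⟨ r≡ ⟩
        segment u j k                                  ≡⟨ segment-split u (<⇒≤ (p<next j)) next≤k ⟩
        segment u j (next j) ++ segment u (next j) k   ≡⟨ cong₂ _++_ (sym (R-type occ-j)) segment≡ ⟩
        R (type j) ++ concatMap R ys                   ∎)
      where
      open ≡-Reasoning
      occ-j = proj₁ (v⇒S v-at-j)
      S-j = proj₂ (v⇒S v-at-j)
      occ-k = proj₁ (v⇒S v-at-k)
      S-k = proj₂ (v⇒S v-at-k)
      next≤k : next j ≤ k
      next≤k = next-≤ j<k occ-k
      outside : ∀ {m} → next j ≤ m → m < k → Occ m → S (type m) ≡ false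
      outside {m} next≤m m<k occ-m with S (type m) in S-m
      ... | false = refl
      ... | true  = contradiction (S⇒v occ-m S-m) (none m (<-≤-trans (p<next j) next≤m) m<k)

    no-end-between : ∀ {a q q′ m} → (∀ {p} → Occ p → S (type p) ≡ true → u (next p ∸ 1) ≡ a) →
                     (∀ n → q < n → n < q′ → ¬ OccursAt u (a ∷ w) n) →
                     q < m → next m ≤ q′ → Occ m → S (type m) ≡ false
    no-end-between {a} {q} {q′} {m} S⇒a none q<m next≤q′ occ-m with S (type m) in S-m
    ... | false = refl
    ... | true  = contradiction aw-at-m′ (none m′ q<m′ m′<q′)
      where
      m′ = next m ∸ 1
      q<m′ : q < m′
      q<m′ = ≤-trans q<m (∸-monoˡ-≤ 1 (p<next m))
      m′<q′ : m′ < q′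
      m′<q′ = subst (_≤ q′) (sym (1+[next∸1]≡next m)) next≤q′
      aw-at-m′ : OccursAt u (a ∷ w) m′
      aw-at-m′ = cong₂ _∷_ (S⇒a occ-m S-m) (subst Occ (sym (1+[next∸1]≡next m)) (next-occurs m))

    -- Shifted by one position, a return word of a ∷ w becomes a product of return words of w.
    return-word-as-end : ∀ {a r} → (∀ {p} → Occ p → u (next p ∸ 1) ≡ a → S (type p) ≡ true) →
                         (∀ {p} → Occ p → S (type p) ≡ true → u (next p ∸ 1) ≡ a) →
                         (∀ {q} → u q ≡ a → Occ (suc q) → ∃ λ s → S s ≡ true × G s (type (suc q)) ≡ true) →
                         ReturnWord u (a ∷ w) r →
                         ∃ λ e → IsExcursion e × r ∷ʳ a ≡ a ∷ unfoldEnd (end e)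
    return-word-as-end {a} {r} a⇒S S⇒a enter (q , q′ , q<q′ , aw-at-q , aw-at-q′ , none , r≡) =
      let s , S-s , G-s = enter (List.∷-injectiveˡ aw-at-q) occ-1+q
          ys , walk , segment≡ = outside-walk 1+q≤p occ-1+q occ-p S-p outside G-s
      in (s , ys , type p) , (S-s , walk) , (begin
        r ∷ʳ a                                              ≡⟨ cong₂ _∷ʳ_ r≡ a≡u-q′ ⟩
        segment u q q′ ∷ʳ u q′                              ≡⟨ segment-last u q<1+q′ ⟨
        segment u q (suc q′)                                ≡⟨ segment-cons u q<1+q′ ⟩
        u q ∷ segment u (suc q) (suc q′)                    ≡⟨ cong₂ _∷_ (List.∷-injectiveˡ aw-at-q)
                                                                         (cong (segment u (suc q)) (sym next-p≡1+q′)) ⟩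
        a ∷ segment u (suc q) (next p)                      ≡⟨ cong (a ∷_) (segment-split u 1+q≤p p≤next) ⟩
        a ∷ (segment u (suc q) p ++ segment u p (next p))   ≡⟨ cong (a ∷_) (cong₂ _++_ segment≡ (sym (R-type occ-p))) ⟩
        a ∷ (concatMap R ys ++ R (type p))                  ∎)
      where
      open ≡-Reasoning
      occ-1+q = List.∷-injectiveʳ aw-at-q
      a≡u-q′ : a ≡ u q′
      a≡u-q′ = sym (List.∷-injectiveˡ aw-at-q′)
      q<1+q′ : q < suc q′
      q<1+q′ = m<n⇒m<1+n q<q′
      last-before-q′ = previous occ-1+q (s≤s q<q′) (List.∷-injectiveʳ aw-at-q′)
      p = proj₁ last-before-q′
      1+q≤p = proj₁ (proj₂ last-before-q′)
      occ-p = proj₁ (proj₂ (proj₂ last-before-q′))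
      next-p≡1+q′ = proj₂ (proj₂ (proj₂ last-before-q′))
      p≤next : p ≤ next p
      p≤next = <⇒≤ (p<next p)
      S-p : S (type p) ≡ true
      S-p = a⇒S occ-p (subst (λ n → u (n ∸ 1) ≡ a) (sym next-p≡1+q′) (sym a≡u-q′))
      outside : ∀ {m} → suc q ≤ m → m < p → Occ m → S (type m) ≡ false
      outside 1+q≤m m<p occ-m = no-end-between S⇒a none 1+q≤m
        (≤-trans (next-≤ m<p occ-p) (m<1+n⇒m≤n (subst (p <_) next-p≡1+q′ (p<next p)))) occ-m

    fewKeys-impossible : ∀ {K : Set} (_≟K_ : DecidableEquality K) (key : Excursion → K)
                         (Codes : FinWord d → K → Set) → (∀ {r r′ κ} → Codes r κ → Codes r′ κ → r ≡ r′) →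
                         ∀ {v} → HasExactlyThreeReturnWords u v →
                         (∀ {r} → ReturnWord u v r → ∃ λ e → IsExcursion e × Codes r (key e)) →
                         ¬ T (fewKeys _≟K_ key 3)
    fewKeys-impossible {K} _≟K_ key Codes codes-functional {v}
                       (_ , _ , _ , r₁≢r₂ , r₁≢r₃ , r₂≢r₃ , ret₁ , ret₂ , ret₃ , _) encode few =
      atMostTwo-pigeonhole _≟K_ (proj₂ (Equivalence.to T-∧ few)) (keyed ret₁) (keyed ret₂) (keyed ret₃)
        (distinct ret₁ ret₂ r₁≢r₂) (distinct ret₁ ret₃ r₁≢r₃) (distinct ret₂ ret₃ r₂≢r₃)
      where
      code : ∀ {r} → ReturnWord u v r → K
      code ret = key (proj₁ (encode ret))
      keyed : ∀ {r} (ret : ReturnWord u v r) → code ret ∈ map key (excursions 3)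
      keyed ret = ∈-map⁺ key (excursions-complete {n = 3} (proj₁ (Equivalence.to T-∧ few))
                                                         (proj₁ (proj₂ (encode ret))))
      distinct : ∀ {r r′} (ret : ReturnWord u v r) (ret′ : ReturnWord u v r′) → r ≢ r′ → code ret ≢ code ret′
      distinct ret ret′ r≢r′ same = r≢r′ (codes-functional (proj₂ (proj₂ (encode ret)))
                                                           (subst (Codes _) (sym same) (proj₂ (proj₂ (encode ret′)))))

module _ {d : ℕ} {u : Word d} {v : FinWord d} where

  returnWord : HasExactlyThreeReturnWords u v → Fin 3 → FinWord d
  returnWord (r₁ , _)         zero             = r₁
  returnWord (_ , r₂ , _)     (suc zero)       = r₂
  returnWord (_ , _ , r₃ , _) (suc (suc zero)) = r₃

  returnWord-returns : ∀ three i → ReturnWord u v (returnWord three i)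
  returnWord-returns (_ , _ , _ , _ , _ , _ , ret₁ , _)         zero             = ret₁
  returnWord-returns (_ , _ , _ , _ , _ , _ , _ , ret₂ , _)     (suc zero)       = ret₂
  returnWord-returns (_ , _ , _ , _ , _ , _ , _ , _ , ret₃ , _) (suc (suc zero)) = ret₃

  returnWord-covers : ∀ three {r} → ReturnWord u v r → ∃ λ i → r ≡ returnWord three i
  returnWord-covers (_ , _ , _ , _ , _ , _ , _ , _ , _ , covers) ret with covers _ ret
  ... | inj₁ r≡r₁        = zero , r≡r₁
  ... | inj₂ (inj₁ r≡r₂) = suc zero , r≡r₂
  ... | inj₂ (inj₂ r≡r₃) = suc (suc zero) , r≡r₃

R₃⇒recurrent : ∀ {d} {u : Word d} → R₃ u → Recurrent u
R₃⇒recurrent {u = u} r3 = return-words⇒recurrent u λ v v-factor → _ , returnWord-returns (r3 v v-factor) zero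

bilateral<0⇒ : ∀ nb nl nr → bilateral nb nl nr ℤ.< ℤ.+ 0 → nb + 1 < nl + nr
bilateral<0⇒ nb nl nr B<0 = ℤₚ.drop‿+<+
  (subst (ℤ._< ℤ.+ (nl + nr)) (identity (ℤ.+ nb) (ℤ.+ nl) (ℤ.+ nr)) (ℤₚ.+-monoˡ-< (ℤ.+ (nl + nr)) B<0))
  where
  identity : ∀ a b c → (((a ℤ.- b) ℤ.- c) ℤ.+ ℤ.+ 1) ℤ.+ (b ℤ.+ c) ≡ a ℤ.+ ℤ.+ 1
  identity = solve-∀

module WeakBispecialFactors {d : ℕ} (u : Word d) (r3 : R₃ u) (w : FinWord d) (w-factor : Factor u w) where

  R : Fin 3 → FinWord d
  R = returnWord (r3 w w-factor)

  open TypedOccurrences u (R₃⇒recurrent r3) w w-factor R (returnWord-returns _) (returnWord-covers _)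

  module _ {nb : ℕ} (bi-card : HasCard (BiExt u w) nb) where

    open Factorisation (factorise Fin._≟_ lastLetter) renaming
      (partition to πˡ; label to labelˡ; label-injective to labelˡ-injective; factorises to lastLetter-factorises;
       same-value⇔same-block to lastLetter≡⇔same-block)
    open Factorisation (factorise Fin._≟_ rightLetter) renaming
      (partition to πʳ; label to labelʳ; label-injective to labelʳ-injective; factorises to rightLetter-factorises;
       same-value⇔same-block to rightLetter≡⇔same-block)
    open import Data.List.Membership.DecPropositional (Product.≡-dec (Fin._≟_ {d}) (Fin._≟_ {d})) using (_∈?_)

    bi-table : Table (blocks πˡ) (blocks πʳ)
    bi-table = tabulate λ i → tabulate λ j → does ((labelˡ i , labelʳ j) ∈? proj₁ bi-card)

    open Configuration πˡ πʳ bi-table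

    bi-table-entry : ∀ i j → entry bi-table i j ≡ does ((labelˡ i , labelʳ j) ∈? proj₁ bi-card)
    bi-table-entry i j = trans (cong (λ row → lookup row j) (lookup∘tabulate _ i)) (lookup∘tabulate _ j)

    G-biext : ∀ {x y} → BiExt u w (lastLetter x , rightLetter y) → G x y ≡ true
    G-biext {x} {y} biext = trans (bi-table-entry (block πˡ x) (block πʳ y)) (dec-true (_ ∈? _) ∈bi-list)
      where
      ∈bi-list : (labelˡ (block πˡ x) , labelʳ (block πʳ y)) ∈ proj₁ bi-card
      ∈bi-list = subst (_∈ _) (cong₂ _,_ (lastLetter-factorises x) (rightLetter-factorises y))
                  (Equivalence.from (proj₂ (proj₂ (proj₂ bi-card)) _) biext)

    G-step : ∀ {p} → Occ p → G (type p) (type (next p)) ≡ true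
    G-step occ = G-biext (transition occ)

    edges-biext : ∀ {e} → e ∈ edges → BiExt u w (labelˡ (proj₁ e) , labelʳ (proj₂ e))
    edges-biext {i , j} e∈edges =
      Equivalence.to (proj₂ (proj₂ (proj₂ bi-card)) _)
        (does≡true⇒ (_ ∈? _) (trans (sym (bi-table-entry i j)) (Equivalence.to T-≡ entry-ij)))
      where
      entry-ij : T (entry bi-table i j)
      entry-ij = proj₂ (∈-filter⁻ (λ (i , j) → T? (entry bi-table i j))
                                  {xs = cartesianProduct (allFin _) (allFin _)} e∈edges)

    edges≤nb : length edges ≤ nb
    edges≤nb = HasCard-≥-injection (λ (i , j) → labelˡ i , labelʳ j) labels-injective bi-card unique-edges edges-biext
      where
      labels-injective : Injective _≡_ _≡_ (λ ((i , j) : Fin (blocks πˡ) × Fin (blocks πʳ)) → labelˡ i , labelʳ j)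
      labels-injective same = cong₂ _,_ (labelˡ-injective (cong proj₁ same)) (labelʳ-injective (cong proj₂ same))
      unique-edges : Unique edges
      unique-edges = Unique.filter⁺ _ (Unique.cartesianProduct⁺ (Unique.allFin⁺ _) (Unique.allFin⁺ _))

    rightLetter≡⇔sameBlock : ∀ {i x} → rightLetter x ≡ rightLetter i ⇔ sameBlock πʳ i x ≡ true
    rightLetter≡⇔sameBlock = ⇔-trans rightLetter≡⇔same-block (⇔-sym (sameBlock⇔ πʳ))

    lastLetter≡⇔sameBlock : ∀ {i x} → lastLetter x ≡ lastLetter i ⇔ sameBlock πˡ i x ≡ true
    lastLetter≡⇔sameBlock = ⇔-trans lastLetter≡⇔same-block (⇔-sym (sameBlock⇔ πˡ))

    few-starts-impossible : ∀ i → ¬ T (Excursions.fewStarts (sameBlock πʳ i) G 3)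
    few-starts-impossible i =
      fewKeys-impossible _ start (λ r κ → r ≡ unfoldStart κ) (λ r≡ r′≡ → trans r≡ (sym r′≡))
        (r3 (w ∷ʳ rightLetter i) (rep i , occurs-∷ʳ⁺ u (rep-occurs i) refl)) (return-word-as-start wb⇒S S⇒wb)
      where
      open Walks (sameBlock πʳ i) G G-step
      wb⇒S : ∀ {p} → OccursAt u (w ∷ʳ rightLetter i) p → Occ p × sameBlock πʳ i (type p) ≡ true
      wb⇒S w-right-at =
        let occ , b≡ = occurs-∷ʳ⁻ u w-right-at
        in occ , Equivalence.to rightLetter≡⇔sameBlock (trans (sym (rightLetter-type occ)) b≡)
      S⇒wb : ∀ {p} → Occ p → sameBlock πʳ i (type p) ≡ true → OccursAt u (w ∷ʳ rightLetter i) p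
      S⇒wb occ same = occurs-∷ʳ⁺ u occ (trans (rightLetter-type occ) (Equivalence.from rightLetter≡⇔sameBlock same))

    few-ends-impossible : ∀ i → ¬ T (Excursions.fewEnds (sameBlock πˡ i) G 3)
    few-ends-impossible i =
      fewKeys-impossible _ end (λ r κ → r ∷ʳ lastLetter i ≡ lastLetter i ∷ unfoldEnd κ)
        (λ r≡ r′≡ → List.∷ʳ-injectiveˡ _ _ (trans r≡ (sym r′≡)))
        (r3 (lastLetter i ∷ w) (next (rep i) ∸ 1 , cong₂ _∷_ refl w-at))
        (return-word-as-end last⇒S S⇒last enter)
      where
      open Walks (sameBlock πˡ i) G G-step
      w-at : Occ (suc (next (rep i) ∸ 1))
      w-at = subst Occ (sym (1+[next∸1]≡next (rep i))) (next-occurs (rep i))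
      last⇒S : ∀ {p} → Occ p → u (next p ∸ 1) ≡ lastLetter i → sameBlock πˡ i (type p) ≡ true
      last⇒S occ last≡ = Equivalence.to lastLetter≡⇔sameBlock (trans (sym (lastLetter-type occ)) last≡)
      S⇒last : ∀ {p} → Occ p → sameBlock πˡ i (type p) ≡ true → u (next p ∸ 1) ≡ lastLetter i
      S⇒last occ same = trans (lastLetter-type occ) (Equivalence.from lastLetter≡⇔sameBlock same)
      enter : ∀ {q} → u q ≡ lastLetter i → Occ (suc q) → ∃ λ s → sameBlock πˡ i s ≡ true × G s (type (suc q)) ≡ true
      enter {q} u-q≡ occ = i , Equivalence.to lastLetter≡⇔sameBlock refl ,
                           G-biext (q , cong₂ _∷_ u-q≡ (occurs-∷ʳ⁺ u occ (rightLetter-type occ)))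

    isWeak-holds : ∀ {nl nr} → HasCard (LeftExt u w) nl → HasCard (RightExt u w) nr →
                   nb + 1 < nl + nr → T isWeak
    isWeak-holds {nl} {nr} left-card right-card weak = <⇒<ᵇ (begin-strict
      length edges + 1         ≤⟨ +-monoˡ-≤ 1 edges≤nb ⟩
      nb + 1                   <⟨ weak ⟩
      nl + nr                  ≤⟨ +-mono-≤ (HasCard-≤-image labelˡ left-card left-block)
                                           (HasCard-≤-image labelʳ right-card right-block) ⟩
      blocks πˡ + blocks πʳ    ∎)
      where
      open ≤-Reasoning
      left-block : ∀ {a} → LeftExt u w a → ∃ λ c → a ≡ labelˡ c
      left-block ext = let x , a≡ = left-extension-type ext in block πˡ x , trans a≡ (lastLetter-factorises x)
      right-block : ∀ {b} → RightExt u w b → ∃ λ c → b ≡ labelʳ c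
      right-block ext = let x , b≡ = right-extension-type ext in block πʳ x , trans b≡ (rightLetter-factorises x)

    weak-impossible : ∀ {nl nr} → HasCard (LeftExt u w) nl → HasCard (RightExt u w) nr → ¬ nb + 1 < nl + nr
    weak-impossible left-card right-card weak =
      let i , refuted = Any.satisfied (any⁻ refutedAt (allFin 3)
                          (weak-configurations-are-refuted πˡ πʳ bi-table (isWeak-holds left-card right-card weak)))
      in either (few-starts-impossible i) (few-ends-impossible i) (Equivalence.to T-∨ refuted)

corollary5p6 : ∀ (d : ℕ) (u : Word d) → R₃ u → ∀ w → Factor u w → ¬ WeakBispecial u w
corollary5p6 d u r3 w w-factor (nb , nl , nr , bi-card , left-card , right-card , B<0) =
  WeakBispecialFactors.weak-impossible u r3 w w-factor bi-card left-card right-card (bilateral<0⇒ nb nl nr B<0)
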